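{- Let $\mathfrak{M}$ be the class of all numerical semigroups $S$ with $\mathrm{c}(S)\le 3\,\mathrm{m}(S)$, and let $\mathfrak{D}$ be the class of all numerical semigroups $S$ with $3\,\mathrm{d}(S)\ge \mathrm{m}(S)$. Then both $\mathfrak{D}\setminus\mathfrak{M}$ and $\mathfrak{M}\setminus\mathfrak{D}$ are infinite sets. Equivalently, neither of the properties "$\mathrm{c}\le 3\mathrm{m}$" and "$3\mathrm{d}\ge \mathrm{m}$" is a quasi generalization of the other.
   Context: A numerical semigroup is a subset $S\subseteq\mathbb{N}=\{0,1,2,\dots\}$ containing $0$, closed under addition, with $\mathbb{N}\setminus S$ finite. The multiplicity $\mathrm{m}(S)$ is the least positive element of $S$; the conductor $\mathrm{c}(S)$ is the smallest integer $c$ such that every integer $\ge c$ lies in $S$ (i.e. the Frobenius number plus one); the embedding dimension $\mathrm{d}(S)$ is the number of minimal generators of $S$ (elements of $S\setminus\{0\}$ that are not sums of two elements of $S\setminus\{0\}$). For properties $\mathcal{P},\mathcal{Q}$ of numerical semigroups with classes $\mathfrak{P},\mathfrak{Q}$ of semigroups satisfying them, $\mathcal{P}$ is a quasi generalization of $\mathcal{Q}$ if $\mathfrak{Q}\setminus\mathfrak{P}$ is finite (possibly empty). -}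

module Defs where

open import Data.Nat using (ℕ; zero; suc; _+_; _*_; _≤_; _<_)
open import Data.Bool using (Bool; true; false)
open import Data.Product using (Σ; ∃; _×_; _,_)
open import Data.List using (List; length)
open import Data.List.Membership.Propositional using (_∈_)
open import Data.List.Relation.Unary.Unique.Propositional using (Unique)
open import Relation.Binary.PropositionalEquality using (_≡_)
open import Relation.Nullary using (¬_)
open import Function.Bundles using (_⇔_)

record NumericalSemigroup : Set where
  field
    mem      : ℕ → Bool
    has-zero : mem 0 ≡ true
    closed   : ∀ a b → mem a ≡ true → mem b ≡ true → mem (a + b) ≡ true
    cofinite : ∃ λ N → ∀ n → N ≤ n → mem n ≡ true

open NumericalSemigroup public

_∈S_ : ℕ → NumericalSemigroup → Set
x ∈S S = mem S x ≡ true

_≈S_ : NumericalSemigroup → NumericalSemigroup → Set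
S ≈S T = ∀ n → mem S n ≡ mem T n

IsMultiplicity : NumericalSemigroup → ℕ → Set
IsMultiplicity S m = (0 < m) × (m ∈S S) × (∀ x → 0 < x → x ∈S S → m ≤ x)

IsConductor : NumericalSemigroup → ℕ → Set
IsConductor S c =
  (∀ n → c ≤ n → n ∈S S) ×
  (∀ c' → (∀ n → c' ≤ n → n ∈S S) → c ≤ c')

IsMinimalGenerator : NumericalSemigroup → ℕ → Set
IsMinimalGenerator S x =
  (0 < x) × (x ∈S S) ×
  ¬ (Σ ℕ λ a → Σ ℕ λ b → (0 < a) × (a ∈S S) × (0 < b) × (b ∈S S) × (a + b ≡ x))

IsEmbeddingDimension : NumericalSemigroup → ℕ → Set
IsEmbeddingDimension S d =
  Σ (List ℕ) λ l → Unique l × (∀ x → (x ∈ l) ⇔ IsMinimalGenerator S x) × (length l ≡ d)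

InM : NumericalSemigroup → Set
InM S = Σ ℕ λ m → Σ ℕ λ c → IsMultiplicity S m × IsConductor S c × (c ≤ 3 * m)

InD : NumericalSemigroup → Set
InD S = Σ ℕ λ m → Σ ℕ λ d → IsMultiplicity S m × IsEmbeddingDimension S d × (m ≤ 3 * d)

InfiniteClass : (NumericalSemigroup → Set) → Set
InfiniteClass P =
  Σ (ℕ → NumericalSemigroup) λ f →
    (∀ i → P (f i)) × (∀ i j → f i ≈S f j → i ≡ j)

-- A numerical semigroup of multiplicity 2 lies in 𝔇, because its multiplicity is always a
-- minimal generator, so d ≥ 1; the hyperelliptic semigroup ⟨2, 2k+3⟩ has the gap
-- 2k+1 > 3·2, so it is not in 𝔐 once k ≥ 3. Conversely, for m = t² let
-- S = {0} ∪ A ∪ [2m, ∞) with A = {m + i, m + jt : i, j < t}. Its conductor is 2m ≤ 3m,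
-- and every x ≥ 2m is a sum of two nonzero elements (x = (m + i) + (m + jt) where
-- x − 2m = i + jt if x < 3m, and x = m + (x − m) otherwise), so all minimal generators
-- lie in A and d ≤ 2t < t²/3 for t ≥ 7. Within each family, two members are told apart
-- by a gap of one that the other contains.
module Submission where

open import Defs
open import Level using (0ℓ)
open import Data.Bool using (true)
import Data.Bool.Properties as Bool
open import Data.Empty using (⊥-elim)
open import Data.List using (List; []; _∷_; length; map; upTo; _++_; filter)
open import Data.List.Properties using (length-++; length-map; length-upTo; length-removeAt′)
open import Data.List.Membership.Propositional using (_∈_; _─_)
open import Data.List.Membership.Propositional.Properties
  using (∈-map⁺; ∈-map⁻; ∈-++⁺ˡ; ∈-++⁺ʳ; ∈-++⁻; ∈-upTo⁺; ∈-upTo⁻; ∈-filter⁺; ∈-filter⁻; ∈-length)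
open import Data.List.Relation.Binary.Subset.Propositional using (_⊆_)
open import Data.List.Relation.Unary.Any using (here; there)
open import Data.List.Relation.Unary.All as All using ()
open import Data.List.Relation.Unary.AllPairs using (_∷_)
open import Data.List.Relation.Unary.Unique.Propositional using (Unique)
open import Data.List.Relation.Unary.Unique.Propositional.Properties using (filter⁺; upTo⁺)
open import Data.Nat using (ℕ; suc; pred; _+_; _*_; _∸_; _≤_; _<_; z≤n; s≤s; z<s; _<?_; _≤?_)
open import Data.Nat.Properties
open import Data.List.Membership.DecPropositional _≟_ using (_∈?_)
open import Data.Nat.Divisibility using (_∣_; _∣?_; ∣m∣n⇒∣m+n; ∣m+n∣m⇒∣n; m∣m*n; ∣1⇒≡1; ∣-refl)
open import Data.Nat.DivMod using (_%_; _/_; m%n<n; m≡m%n+[m/n]*n; m<n*o⇒m/o<n)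
open import Algebra.Properties.CommutativeSemigroup +-commutativeSemigroup using (interchange)
open import Data.Product using (Σ; ∃; ∃₂; _×_; _,_; proj₁; proj₂)
open import Data.Sum using (_⊎_; inj₁; inj₂)
open import Function using (_∘_)
open import Function.Bundles using (mk⇔; Equivalence)
open import Relation.Binary.Definitions using (tri<; tri≈; tri>)
open import Relation.Binary.PropositionalEquality using (_≡_; _≢_; refl; sym; trans; cong; subst; module ≡-Reasoning)
open import Relation.Nullary using (¬_; yes; no; does; ¬?)
open import Relation.Nullary.Decidable using (_×-dec_; _⊎-dec_; dec-true; map′)
open import Relation.Unary using (Pred; Decidable)

open Equivalence using (to; from)

unique-length-≤ : ∀ {xs ys : List ℕ} → Unique xs → xs ⊆ ys → length xs ≤ length ys
unique-length-≤ {[]} _ _ = z≤n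
unique-length-≤ {x ∷ xs} {ys} (x∉xs ∷ xs!) x∷xs⊆ys = begin
  suc (length xs)       ≤⟨ s≤s (unique-length-≤ xs! xs⊆ys─x) ⟩
  suc (length (ys ─ x∈ys)) ≡⟨ sym (length-removeAt′ ys _) ⟩
  length ys             ∎
  where
  open ≤-Reasoning
  x∈ys = x∷xs⊆ys (here refl)
  ∈-─ : ∀ {y zs} (p : x ∈ zs) → y ∈ zs → y ≢ x → y ∈ zs ─ p
  ∈-─ (here refl) (here refl) y≢x = ⊥-elim (y≢x refl)
  ∈-─ (here refl) (there q)   _   = q
  ∈-─ (there p)   (here y≡z)  _   = here y≡z
  ∈-─ (there p)   (there q)   y≢x = there (∈-─ p q y≢x)
  xs⊆ys─x : xs ⊆ ys ─ x∈ys
  xs⊆ys─x y∈xs = ∈-─ x∈ys (x∷xs⊆ys (there y∈xs)) (λ y≡x → All.lookup x∉xs y∈xs (sym y≡x))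

module FromDecidable {P : Pred ℕ 0ℓ} (P? : Decidable P) (P0 : P 0)
                    (P+ : ∀ {a b} → P a → P b → P (a + b)) (N : ℕ) (P≥ : ∀ {n} → N ≤ n → P n) where

  ∈⁺ : ∀ {n} → P n → does (P? n) ≡ true
  ∈⁺ {n} = dec-true (P? n)

  ∈⁻ : ∀ {n} → does (P? n) ≡ true → P n
  ∈⁻ {n} n∈ with P? n | n∈
  ... | yes Pn | _ = Pn
  ... | no _   | ()

  semigroup : NumericalSemigroup
  semigroup = record
    { mem      = λ n → does (P? n)
    ; has-zero = ∈⁺ P0
    ; closed   = λ _ _ a∈ b∈ → ∈⁺ (P+ (∈⁻ a∈) (∈⁻ b∈))
    ; cofinite = N , λ _ N≤n → ∈⁺ (P≥ N≤n)
    }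

Decomposable : NumericalSemigroup → ℕ → Set
Decomposable S x = Σ ℕ λ a → Σ ℕ λ b → (0 < a) × (a ∈S S) × (0 < b) × (b ∈S S) × (a + b ≡ x)

module _ (S : NumericalSemigroup) where

  ∈S? : Decidable (_∈S S)
  ∈S? n = mem S n Bool.≟ true

  decomposable? : Decidable (Decomposable S)
  decomposable? x = map′ fromBounded toBounded (anyUpTo? summand? x)
    where
    Summand : Pred ℕ 0ℓ
    Summand a = (0 < a) × (a ∈S S) × (0 < x ∸ a) × ((x ∸ a) ∈S S)
    summand? : Decidable Summand
    summand? a = (0 <? a) ×-dec ∈S? a ×-dec (0 <? x ∸ a) ×-dec ∈S? (x ∸ a)
    fromBounded : ∃ (λ a → a < x × Summand a) → Decomposable S x
    fromBounded (a , a<x , 0<a , a∈S , 0<b , b∈S) =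
      a , x ∸ a , 0<a , a∈S , 0<b , b∈S , m+[n∸m]≡n (<⇒≤ a<x)
    toBounded : Decomposable S x → ∃ λ a → a < x × Summand a
    toBounded (a , b , 0<a , a∈S , 0<b , b∈S , refl) =
      a , m<m+n a 0<b , 0<a , a∈S , subst (λ c → 0 < c × c ∈S S) (sym (m+n∸m≡n a b)) (0<b , b∈S)

  minimalGenerator? : Decidable (IsMinimalGenerator S)
  minimalGenerator? x = (0 <? x) ×-dec ∈S? x ×-dec ¬? (decomposable? x)

  decomposable-≥ : ∀ {N x} → (∀ n → N ≤ n → n ∈S S) → suc N + suc N ≤ x → Decomposable S x
  decomposable-≥ {N} {x} N≤⇒∈S 2[1+N]≤x =
    suc N , x ∸ suc N , z<s , N≤⇒∈S _ (n≤1+n N) ,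
    <-≤-trans z<s 1+N≤b , N≤⇒∈S _ (≤-trans (n≤1+n N) 1+N≤b) ,
    m+[n∸m]≡n (≤-trans (m≤m+n (suc N) (suc N)) 2[1+N]≤x)
    where
    1+N≤b : suc N ≤ x ∸ suc N
    1+N≤b = subst (_≤ x ∸ suc N) (m+n∸n≡m (suc N) (suc N)) (∸-monoˡ-≤ (suc N) 2[1+N]≤x)

  embeddingDimension : ∃ (IsEmbeddingDimension S)
  embeddingDimension =
    length generators , generators , filter⁺ minimalGenerator? (upTo⁺ bound) ,
    (λ x → mk⇔ (proj₂ ∘ ∈-filter⁻ minimalGenerator? {xs = upTo bound})
               (λ x-gen → ∈-filter⁺ minimalGenerator? {xs = upTo bound} (∈-upTo⁺ (bounded x-gen)) x-gen)) ,
    refl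
    where
    N bound : ℕ
    N = proj₁ (cofinite S)
    bound = suc N + suc N
    generators : List ℕ
    generators = filter minimalGenerator? (upTo bound)
    bounded : ∀ {x} → IsMinimalGenerator S x → x < bound
    bounded (_ , _ , indecomposable) = ≰⇒> (indecomposable ∘ decomposable-≥ (proj₂ (cofinite S)))

  multiplicity-unique : ∀ {m n} → IsMultiplicity S m → IsMultiplicity S n → m ≡ n
  multiplicity-unique (0<m , m∈S , m≤) (0<n , n∈S , n≤) = ≤-antisym (m≤ _ 0<n n∈S) (n≤ _ 0<m m∈S)

  ∉S-below-multiplicity : ∀ {m x} → IsMultiplicity S m → 0 < x → x < m → ¬ x ∈S S
  ∉S-below-multiplicity (_ , _ , m≤) 0<x x<m x∈S = <⇒≱ x<m (m≤ _ 0<x x∈S)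

  multiplicity-minimalGenerator : ∀ {m} → IsMultiplicity S m → IsMinimalGenerator S m
  multiplicity-minimalGenerator μ@(0<m , m∈S , _) =
    0<m , m∈S , λ (a , b , 0<a , a∈S , 0<b , _ , a+b≡m) →
      ∉S-below-multiplicity μ 0<a (subst (a <_) a+b≡m (m<m+n a 0<b)) a∈S

  gap<bound : ∀ {c g} → (∀ n → c ≤ n → n ∈S S) → ¬ g ∈S S → g < c
  gap<bound c≤⇒∈S g∉S = ≰⇒> (g∉S ∘ c≤⇒∈S _)

  isConductor-gap : ∀ {c g} → (∀ n → c ≤ n → n ∈S S) → ¬ g ∈S S → c ≤ suc g → IsConductor S c
  isConductor-gap c≤⇒∈S g∉S c≤1+g = c≤⇒∈S , λ _ c′≤⇒∈S → ≤-trans c≤1+g (gap<bound c′≤⇒∈S g∉S)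

  embeddingDimension-pos : ∀ {m d} → IsMultiplicity S m → IsEmbeddingDimension S d → 0 < d
  embeddingDimension-pos μ (_ , _ , generators , refl) =
    ∈-length (from (generators _) (multiplicity-minimalGenerator μ))

  embeddingDimension-≤ : ∀ {d G} → IsEmbeddingDimension S d → (∀ {x} → IsMinimalGenerator S x → x ∈ G) →
                         d ≤ length G
  embeddingDimension-≤ (_ , unique , generators , refl) ⊆G =
    unique-length-≤ unique (⊆G ∘ to (generators _))

  inD-if-multiplicity≤3 : ∀ {m} → IsMultiplicity S m → m ≤ 3 → InD S
  inD-if-multiplicity≤3 μ m≤3 with d , isDim ← embeddingDimension =
    _ , d , μ , isDim , ≤-trans m≤3 (*-monoʳ-≤ 3 (embeddingDimension-pos μ isDim))

  ¬inD-if-3d<m : ∀ {m b} → IsMultiplicity S m → (∀ {d} → IsEmbeddingDimension S d → d ≤ b) → 3 * b < m →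
                 ¬ InD S
  ¬inD-if-3d<m {m} {b} μ bounded 3b<m (m′ , d , μ′ , isDim , m′≤3d) = <⇒≱ 3b<m (begin
    m      ≡⟨ multiplicity-unique μ μ′ ⟩
    m′     ≤⟨ m′≤3d ⟩
    3 * d  ≤⟨ *-monoʳ-≤ 3 (bounded isDim) ⟩
    3 * b  ∎)
    where open ≤-Reasoning

  ¬inM-if-gap≥3m : ∀ {m g} → IsMultiplicity S m → ¬ g ∈S S → 3 * m ≤ g → ¬ InM S
  ¬inM-if-gap≥3m {g = g} μ g∉S 3m≤g (m′ , c , μ′ , (c≤⇒∈S , _) , c≤3m′) =
    g∉S (c≤⇒∈S g (≤-trans c≤3m′ (subst (λ k → 3 * k ≤ g) (multiplicity-unique μ μ′) 3m≤g)))

separated⇒injective : (f : ℕ → NumericalSemigroup) → (∀ {i j} → i < j → ∃ λ x → x ∈S f i × ¬ x ∈S f j) →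
                      ∀ i j → f i ≈S f j → i ≡ j
separated⇒injective f separated i j fi≈fj with <-cmp i j
... | tri≈ _ i≡j _ = i≡j
... | tri< i<j _ _ with x , x∈fi , x∉fj ← separated i<j = ⊥-elim (x∉fj (trans (sym (fi≈fj x)) x∈fi))
... | tri> _ _ j<i with x , x∈fj , x∉fi ← separated j<i = ⊥-elim (x∉fi (trans (fi≈fj x) x∈fj))

-- ⟨2, 2k+3⟩ = 2ℕ ∪ [2k+2, ∞)
module Hyperelliptic (k : ℕ) where

  EvenOrLarge : Pred ℕ 0ℓ
  EvenOrLarge n = 2 ∣ n ⊎ 2 * suc k ≤ n

  evenOrLarge-+ : ∀ {a b} → EvenOrLarge a → EvenOrLarge b → EvenOrLarge (a + b)
  evenOrLarge-+ (inj₁ 2∣a) (inj₁ 2∣b) = inj₁ (∣m∣n⇒∣m+n 2∣a 2∣b)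
  evenOrLarge-+ {a} {b} (inj₂ large) _ = inj₂ (≤-trans large (m≤m+n a b))
  evenOrLarge-+ {a} {b} (inj₁ _) (inj₂ large) = inj₂ (≤-trans large (m≤n+m b a))

  open FromDecidable (λ n → (2 ∣? n) ⊎-dec (2 * suc k ≤? n)) (inj₁ (m∣m*n 0)) evenOrLarge-+ (2 * suc k) inj₂
    public

  ¬2∣odd : ∀ n → ¬ 2 ∣ suc (2 * n)
  ¬2∣odd n 2∣odd with () ← ∣1⇒≡1 (∣m+n∣m⇒∣n (subst (2 ∣_) (+-comm 1 (2 * n)) 2∣odd) (m∣m*n n))

  odd-gap : ¬ suc (2 * k) ∈S semigroup
  odd-gap odd∈S with ∈⁻ odd∈S
  ... | inj₁ 2∣odd = ¬2∣odd k 2∣odd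
  ... | inj₂ large = 1+n≰n (subst (_≤ suc (2 * k)) (*-suc 2 k) large)

  isMultiplicity : IsMultiplicity semigroup 2
  isMultiplicity = z<s , ∈⁺ (inj₁ ∣-refl) , 2≤
    where
    2≤ : ∀ x → 0 < x → x ∈S semigroup → 2 ≤ x
    2≤ 0 () _
    2≤ (suc (suc _)) _ _ = s≤s (s≤s z≤n)
    2≤ 1 _ 1∈S with ∈⁻ 1∈S
    ... | inj₁ 2∣1  = ⊥-elim (¬2∣odd 0 2∣1)
    ... | inj₂ large = ⊥-elim (<⇒≱ (s≤s (s≤s z≤n)) (≤-trans (*-monoʳ-≤ 2 (s≤s z≤n)) large))

  inD : InD semigroup
  inD = inD-if-multiplicity≤3 semigroup isMultiplicity (n≤1+n 2)

  ¬inM-if-3≤k : 3 ≤ k → ¬ InM semigroup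
  ¬inM-if-3≤k 3≤k = ¬inM-if-gap≥3m semigroup isMultiplicity odd-gap (≤-trans (*-monoʳ-≤ 2 3≤k) (n≤1+n _))

hyperelliptic-separated : ∀ {k l} → k < l →
                          ∃ λ x → x ∈S Hyperelliptic.semigroup k × ¬ x ∈S Hyperelliptic.semigroup l
hyperelliptic-separated {k} {l} k<l =
  suc (2 * l) , Hyperelliptic.∈⁺ k (inj₂ (≤-trans (*-monoʳ-≤ 2 k<l) (n≤1+n _))) , Hyperelliptic.odd-gap l

module SmallConductor (m g : ℕ) (2m≡1+g : m + m ≡ suc g) (A : List ℕ)
                      (A-bounds : ∀ {a} → a ∈ A → m ≤ a × a < g) (m∈A : m ∈ A) where

  Member : Pred ℕ 0ℓ
  Member n = n ≡ 0 ⊎ n ∈ A ⊎ m + m ≤ n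

  0-or-≥m : ∀ {n} → Member n → n ≡ 0 ⊎ m ≤ n
  0-or-≥m (inj₁ n≡0)          = inj₁ n≡0
  0-or-≥m (inj₂ (inj₁ n∈A))   = inj₂ (proj₁ (A-bounds n∈A))
  0-or-≥m (inj₂ (inj₂ 2m≤n))  = inj₂ (≤-trans (m≤m+n m m) 2m≤n)

  member-+ : ∀ {a b} → Member a → Member b → Member (a + b)
  member-+ {a} {b} a∈ b∈ with 0-or-≥m a∈ | 0-or-≥m b∈
  ... | inj₁ refl | _         = b∈
  ... | inj₂ _    | inj₁ refl = subst Member (sym (+-identityʳ a)) a∈
  ... | inj₂ m≤a  | inj₂ m≤b  = inj₂ (inj₂ (+-mono-≤ m≤a m≤b))

  open FromDecidable (λ n → (n ≟ 0) ⊎-dec (n ∈? A) ⊎-dec (m + m ≤? n)) (inj₁ refl) member-+ (m + m) (inj₂ ∘ inj₂)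
    public

  0<m : 0 < m
  0<m = n≢0⇒n>0 λ m≡0 → 0≢1+n (trans (cong (λ x → x + x) (sym m≡0)) 2m≡1+g)

  A-pos : ∀ {a} → a ∈ A → 0 < a
  A-pos a∈A = <-≤-trans 0<m (proj₁ (A-bounds a∈A))

  isMultiplicity : IsMultiplicity semigroup m
  isMultiplicity = 0<m , ∈⁺ (inj₂ (inj₁ m∈A)) , ≥m
    where
    ≥m : ∀ x → 0 < x → x ∈S semigroup → m ≤ x
    ≥m x 0<x x∈S with 0-or-≥m (∈⁻ x∈S)
    ... | inj₁ x≡0 = ⊥-elim (<⇒≢ 0<x (sym x≡0))
    ... | inj₂ m≤x = m≤x

  gap∉S : ¬ g ∈S semigroup
  gap∉S g∈S with ∈⁻ g∈S
  ... | inj₁ g≡0         = n≮0 (subst (m <_) g≡0 (proj₂ (A-bounds m∈A)))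
  ... | inj₂ (inj₁ g∈A)  = <-irrefl refl (proj₂ (A-bounds g∈A))
  ... | inj₂ (inj₂ 2m≤g) = 1+n≰n (subst (_≤ g) 2m≡1+g 2m≤g)

  inM : InM semigroup
  inM = m , m + m , isMultiplicity , isConductor , +-monoʳ-≤ m (m≤m+n m (m + 0))
    where
    isConductor : IsConductor semigroup (m + m)
    isConductor = isConductor-gap semigroup (λ _ → ∈⁺ ∘ inj₂ ∘ inj₂) gap∉S (≤-reflexive 2m≡1+g)

  module _ (A+A-covers : ∀ r → r < m → ∃₂ λ a b → a ∈ A × b ∈ A × a + b ≡ m + m + r) where

    sum-of-A-decomposable : ∀ {n} → (∃₂ λ a b → a ∈ A × b ∈ A × a + b ≡ n) → Decomposable semigroup n
    sum-of-A-decomposable (a , b , a∈A , b∈A , a+b≡n) =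
      a , b , A-pos a∈A , ∈⁺ (inj₂ (inj₁ a∈A)) , A-pos b∈A , ∈⁺ (inj₂ (inj₁ b∈A)) , a+b≡n

    decomposable-≥2m : ∀ {n} → m + m ≤ n → Decomposable semigroup n
    decomposable-≥2m {n} 2m≤n with n <? m + m + m
    ... | yes n<3m = subst (Decomposable semigroup) (m+[n∸m]≡n 2m≤n)
                           (sum-of-A-decomposable (A+A-covers (n ∸ (m + m)) r<m))
      where
      r<m : n ∸ (m + m) < m
      r<m = subst (n ∸ (m + m) <_) (m+n∸m≡n (m + m) m) (∸-monoˡ-< n<3m 2m≤n)
    ... | no n≮3m =
      m , n ∸ m , 0<m , ∈⁺ (inj₂ (inj₁ m∈A)) ,
      <-≤-trans 0<m (≤-trans (m≤m+n m m) 2m≤n∸m) , ∈⁺ (inj₂ (inj₂ 2m≤n∸m)) ,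
      m+[n∸m]≡n (≤-trans (m≤m+n m m) 2m≤n)
      where
      2m≤n∸m : m + m ≤ n ∸ m
      2m≤n∸m = subst (_≤ n ∸ m) (m+n∸n≡m (m + m) m) (∸-monoˡ-≤ m (≮⇒≥ n≮3m))

    minimalGenerator∈A : ∀ {x} → IsMinimalGenerator semigroup x → x ∈ A
    minimalGenerator∈A (0<x , x∈S , indecomposable) with ∈⁻ x∈S
    ... | inj₁ x≡0         = ⊥-elim (<⇒≢ 0<x (sym x≡0))
    ... | inj₂ (inj₁ x∈A)  = x∈A
    ... | inj₂ (inj₂ 2m≤x) = ⊥-elim (indecomposable (decomposable-≥2m 2m≤x))

    ¬inD-if-3[length-A]<m : 3 * length A < m → ¬ InD semigroup
    ¬inD-if-3[length-A]<m =
      ¬inD-if-3d<m semigroup isMultiplicity (λ isDim → embeddingDimension-≤ semigroup isDim minimalGenerator∈A)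

module Square (k : ℕ) where

  t m : ℕ
  t = 7 + k
  m = t * t

  offsets : List ℕ
  offsets = upTo t ++ map (_* t) (upTo t)

  A : List ℕ
  A = map (m +_) offsets

  1+offset<m : ∀ {r} → r ∈ offsets → suc r < m
  1+offset<m r∈ with ∈-++⁻ (upTo t) r∈
  ... | inj₁ i∈ = ≤-trans (s≤s (∈-upTo⁻ i∈)) (m<m*n t t (s≤s (s≤s z≤n)))
  ... | inj₂ jt∈ with j , j∈ , refl ← ∈-map⁻ (_* t) {xs = upTo t} jt∈ = begin
    2 + j * t  ≤⟨ +-monoˡ-≤ (j * t) (s≤s (s≤s z≤n)) ⟩
    t + j * t  ≤⟨ *-monoˡ-≤ t (∈-upTo⁻ j∈) ⟩
    t * t      ∎
    where open ≤-Reasoning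

  -- pred m + m is 2m − 1, and m + m ≡ suc (pred m + m) holds by refl since m = t * t is a successor
  A-bounds : ∀ {a} → a ∈ A → m ≤ a × a < pred m + m
  A-bounds a∈ with r , r∈ , refl ← ∈-map⁻ (m +_) {xs = offsets} a∈ =
    m≤m+n m r , subst (m + r <_) (+-comm m (pred m)) (+-monoʳ-< m (<⇒≤pred (1+offset<m r∈)))

  m∈A : m ∈ A
  m∈A = subst (_∈ A) (+-identityʳ m) (∈-map⁺ (m +_) (∈-++⁺ˡ {ys = map (_* t) (upTo t)} (∈-upTo⁺ {n = t} z<s)))

  A+A-covers : ∀ r → r < m → ∃₂ λ a b → a ∈ A × b ∈ A × a + b ≡ m + m + r
  A+A-covers r r<m =
    m + r % t , m + r / t * t ,
    ∈-map⁺ (m +_) (∈-++⁺ˡ {ys = map (_* t) (upTo t)} (∈-upTo⁺ {n = t} (m%n<n r t))) ,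
    ∈-map⁺ (m +_) (∈-++⁺ʳ (upTo t) (∈-map⁺ (_* t) (∈-upTo⁺ {n = t} (m<n*o⇒m/o<n r<m)))) ,
    trans (interchange m (r % t) m (r / t * t)) (cong (m + m +_) (sym (m≡m%n+[m/n]*n r t)))

  length-A : length A ≡ t + t
  length-A = begin
    length A                                  ≡⟨ length-map (m +_) offsets ⟩
    length offsets                            ≡⟨ length-++ (upTo t) ⟩
    length (upTo t) + length (map (_* t) (upTo t)) ≡⟨ cong (length (upTo t) +_) (length-map (_* t) (upTo t)) ⟩
    length (upTo t) + length (upTo t)         ≡⟨ cong (λ l → l + l) (length-upTo t) ⟩
    t + t                                     ∎
    where open ≡-Reasoning

  open SmallConductor m (pred m + m) refl A A-bounds m∈A public

  ¬inD-square : ¬ InD semigroup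
  ¬inD-square = ¬inD-if-3[length-A]<m A+A-covers (begin-strict
    3 * length A  ≡⟨ cong (3 *_) length-A ⟩
    3 * (t + t)   ≡⟨ *-distribˡ-+ 3 t t ⟩
    3 * t + 3 * t ≡⟨ *-distribʳ-+ t 3 3 ⟨
    6 * t         <⟨ *-monoˡ-< t (m≤m+n 7 k) ⟩
    t * t         ∎)
    where open ≤-Reasoning

square-separated : ∀ {i j} → i < j → ∃ λ x → x ∈S Square.semigroup i × ¬ x ∈S Square.semigroup j
square-separated {i} {j} i<j =
  Square.m i , Square.∈⁺ i (inj₂ (inj₁ (Square.m∈A i))) ,
  ∉S-below-multiplicity (Square.semigroup j) (Square.isMultiplicity j) (Square.0<m i) (*-mono-< ti<tj ti<tj)
  where
  ti<tj : 7 + i < 7 + j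
  ti<tj = +-monoʳ-< 7 i<j

proposition4p3 : InfiniteClass (λ S → InD S × ¬ InM S) × InfiniteClass (λ S → InM S × ¬ InD S)
proposition4p3 =
  (hyperelliptic , (λ i → Hyperelliptic.inD (3 + i) , Hyperelliptic.¬inM-if-3≤k (3 + i) (m≤m+n 3 i)) ,
   separated⇒injective hyperelliptic (hyperelliptic-separated ∘ +-monoʳ-< 3)) ,
  (Square.semigroup , (λ k → Square.inM k , Square.¬inD-square k) ,
   separated⇒injective Square.semigroup square-separated)
  where
  hyperelliptic : ℕ → NumericalSemigroup
  hyperelliptic i = Hyperelliptic.semigroup (3 + i)
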